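{- Let $X$ be the set of shuffle tableaux of shape $(\lambda/\mu)\circledast(\nu/\rho)$ with entries in $[N]$ flagged by a nondecreasing flag $\vec b$, and let $x\in X$. Suppose $f_j(x)\neq0$. Then for every $i\neq j$, the set of unpaired entries $i$ in $x$ is a subset of the set of unpaired entries $i$ in $f_j(x)$ (entries identified by their cells).
   Context: A shuffle tableau of shape $(\lambda/\mu)\circledast(\nu/\rho)$ ($n$ rows each) is a pair $(T,U)$ of semistandard tableaux of shapes $\lambda/\mu$, $\nu/\rho$; row $r$ of $T$ sits at level $2r-1$, row $r$ of $U$ at level $2r$. Reading word: levels $2n,\dots,1$, each left to right. An $i$ in cell $(r,c)$ and $i+1$ in cell $(r+1,c)$ of the same tableau are column paired. For the operator of index $i$: remove column-paired $(i,i+1)$ pairs from the reading word, bracket-match remaining $i$'s (")") with $i+1$'s ("("); an entry $i$ is paired if it is column paired with or matched to an $i+1$, otherwise unpaired. $f_i$ changes the rightmost unpaired $i$ to $i+1$ ($0$ if none). Flagged by $\vec b=(b_1\le\dots\le b_{2n})$: entries at level $\ell$ are $\le b_\ell$. -}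

module Defs where

open import Data.Nat using (ℕ; zero; suc; _+_; _*_; _∸_; _≤_; _<_; _≤ᵇ_; _<ᵇ_; _≡ᵇ_)
open import Data.Bool using (Bool; true; false; _∧_; _∨_; not; if_then_else_)
open import Data.List using (List; []; _∷_; _++_; map; concatMap; upTo; downFrom; filterᵇ; last)
open import Data.Maybe using (Maybe; just; nothing)
open import Data.Product using (_×_; _,_)

-- The two tableaux of a shuffle tableau: T (shape λ/μ) and U (shape ν/ρ).
data Side : Set where
  TS US : Side

_≡ˢ_ : Side → Side → Bool
TS ≡ˢ TS = true
US ≡ˢ US = true
_  ≡ˢ _  = false

-- A cell (side , r , c): row r and column c, both 0-based.
-- Row r of T sits at level 2r+1, row r of U at level 2r+2 (levels 1-based).
Cell : Set
Cell = Side × ℕ × ℕ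

_≡ᶜ_ : Cell → Cell → Bool
(s , r , c) ≡ᶜ (s' , r' , c') = (s ≡ˢ s') ∧ ((r ≡ᵇ r') ∧ (c ≡ᵇ c'))

-- A filling assigns an entry to every cell; only cells of the shape matter.
Filling : Set
Filling = Cell → ℕ

level : Cell → ℕ
level (TS , r , c) = suc (2 * r)
level (US , r , c) = suc (suc (2 * r))

IsPartition : ℕ → (ℕ → ℕ) → Set
IsPartition n p = ∀ r → suc r < n → p (suc r) ≤ p r

Contained : ℕ → (ℕ → ℕ) → (ℕ → ℕ) → Set
Contained n mu lam = ∀ r → r < n → mu r ≤ lam r

module Shape (n : ℕ) (lam mu nu rho : ℕ → ℕ) where

  outer inner : Side → ℕ → ℕ
  outer TS = lam
  outer US = nu
  inner TS = mu
  inner US = rho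

  InShape : Cell → Set
  InShape (s , r , c) = (r < n) × ((inner s r ≤ c) × (c < outer s r))

  inShape? : Cell → Bool
  inShape? (s , r , c) = (r <ᵇ n) ∧ ((inner s r ≤ᵇ c) ∧ (c <ᵇ outer s r))

  record ShuffleTableau (N : ℕ) (b : ℕ → ℕ) (x : Filling) : Set where
    field
      entries   : ∀ a → InShape a → (1 ≤ x a) × (x a ≤ N)
      rowWeak   : ∀ s r c → InShape (s , r , c) → InShape (s , r , suc c) →
                  x (s , r , c) ≤ x (s , r , suc c)
      colStrict : ∀ s r c → InShape (s , r , c) → InShape (s , suc r , c) →
                  x (s , r , c) < x (s , suc r , c)
      flagged   : ∀ a → InShape a → x a ≤ b (level a)

  range : ℕ → ℕ → List ℕ
  range a e = map (a +_) (upTo (e ∸ a))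

  rowCells : Side → ℕ → List Cell
  rowCells s r = map (λ c → (s , r , c)) (range (inner s r) (outer s r))

  -- reading word: levels 2n, 2n-1, …, 1, each row left to right
  readingWord : List Cell
  readingWord = concatMap (λ r → rowCells US r ++ rowCells TS r) (downFrom n)

  colPaired : ℕ → Filling → Cell → Bool
  colPaired i x (s , r , c) = withBelow ∨ above r
    where
    above : ℕ → Bool
    above zero     = false
    above (suc r') = (x (s , r , c) ≡ᵇ suc i) ∧ (inShape? (s , r' , c) ∧ (x (s , r' , c) ≡ᵇ i))
    withBelow : Bool
    withBelow = ((x (s , r , c) ≡ᵇ i) ∧ (inShape? (s , suc r , c) ∧ (x (s , suc r , c) ≡ᵇ suc i)))

  -- bracket matching: i+1 is "(", i is ")"; k counts currently unmatched "(".
  -- Returns the entries i (")") that are not matched, in reading order.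
  unmatched : ℕ → Filling → ℕ → List Cell → List Cell
  unmatched i x k [] = []
  unmatched i x k (a ∷ w) =
    if x a ≡ᵇ suc i then unmatched i x (suc k) w
    else (if x a ≡ᵇ i then close k else unmatched i x k w)
    where
    close : ℕ → List Cell
    close zero    = a ∷ unmatched i x zero w
    close (suc k') = unmatched i x k' w

  unpaired : ℕ → Filling → List Cell
  unpaired i x = unmatched i x zero (filterᵇ (λ a → not (colPaired i x a)) readingWord)

  -- f_i : change the rightmost unpaired i to i+1; nothing stands for 0.
  f : ℕ → Filling → Maybe Filling
  f i x with last (unpaired i x)
  ... | nothing = nothing
  ... | just a  = just (λ a' → if a' ≡ᶜ a then suc i else x a')

-- Since i ≠ j, applying f_j turns a single entry j into j + 1, so every entry i of x is still
-- an i of f_j(x) and every i + 1 of f_j(x) was already an i + 1 of x.  Hence an i that is not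
-- column paired in x is not column paired in f_j(x), and an i + 1 that is not column paired in
-- f_j(x) was not column paired in x.
-- Reading the i-word as brackets, each letter moves in the order "(" < neutral < ")", and
-- such moves can only make more ")" unmatched.
module Submission where

open import Defs
open import Data.Nat using (ℕ; zero; suc; pred; _≤_; _<_; _*_; _≡ᵇ_; z≤n; s≤s)
open import Data.Nat.Properties using (≤-trans; m≤n⇒m≤1+n; pred-mono-≤; pred[n]≤n; ≡ᵇ⇒≡; ≡⇒≡ᵇ; suc-injective)
open import Data.Bool using (Bool; true; false; not; _∧_; if_then_else_; T)
open import Data.Bool.Properties using (∨-identityʳ; T-∧; T-≡)
open import Data.Empty using (⊥; ⊥-elim)
open import Data.Maybe using (just; nothing)
open import Data.Product using (_×_; _,_; proj₂; map₂)
open import Data.Sum using (_⊎_; inj₁; inj₂)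
open import Data.List using (List; []; _∷_; filterᵇ; last)
open import Data.List.Membership.Propositional using (_∈_)
open import Data.List.Relation.Unary.Any using (here; there)
open import Function using (id; _∘_; _⇔_; mk⇔; Equivalence)
open import Relation.Binary.PropositionalEquality using (_≡_; _≢_; refl; sym; trans; cong; cong₂; subst)
open import Relation.Nullary using (¬_)

open Equivalence using (to; from)

data Bracket : Set where
  opening neutral closing : Bracket

data _≼_ : Bracket → Bracket → Set where
  ≼-refl          : ∀ {β} → β ≼ β
  opening≼neutral : opening ≼ neutral
  opening≼closing : opening ≼ closing
  neutral≼closing : neutral ≼ closing

≼-intro : ∀ β β' → (β ≡ closing → β' ≡ closing) → (β' ≡ opening → β ≡ opening) → β ≼ β'
≼-intro opening opening _ _ = ≼-refl
≼-intro opening neutral _ _ = opening≼neutral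
≼-intro opening closing _ _ = opening≼closing
≼-intro neutral neutral _ _ = ≼-refl
≼-intro neutral closing _ _ = neutral≼closing
≼-intro closing closing _ _ = ≼-refl
≼-intro neutral opening _ reflect with () ← reflect refl
≼-intro closing opening preserve _ with () ← preserve refl
≼-intro closing neutral preserve _ with () ← preserve refl

module _ {A : Set} where

  -- The counter is the number of "(" read so far that are not yet matched.
  depth : Bracket → ℕ → ℕ
  depth opening k = suc k
  depth neutral k = k
  depth closing k = pred k

  emit : Bracket → ℕ → A → List A → List A
  emit closing zero a = a ∷_
  emit _       _    _ = id

  unmatchedClosing : (A → Bracket) → ℕ → List A → List A
  unmatchedClosing σ k []      = []
  unmatchedClosing σ k (a ∷ w) = emit (σ a) k a (unmatchedClosing σ (depth (σ a) k) w)

  unmatchedClosing-filterᵇ : ∀ σ (p : A → Bool) k w →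
    unmatchedClosing σ k (filterᵇ p w) ≡ unmatchedClosing (λ a → if p a then σ a else neutral) k w
  unmatchedClosing-filterᵇ σ p k [] = refl
  unmatchedClosing-filterᵇ σ p k (a ∷ w) with p a
  ... | true  = cong (emit (σ a) k a) (unmatchedClosing-filterᵇ σ p (depth (σ a) k) w)
  ... | false = unmatchedClosing-filterᵇ σ p k w

  ∈-unmatchedClosing⇒closing : ∀ σ k w {a} → a ∈ unmatchedClosing σ k w → σ a ≡ closing
  ∈-unmatchedClosing⇒closing σ k (b ∷ w) a∈ with σ b in σb | k
  ... | closing | zero with a∈
  ...   | here refl = σb
  ...   | there a∈w = ∈-unmatchedClosing⇒closing σ zero w a∈w
  ∈-unmatchedClosing⇒closing σ k (b ∷ w) a∈ | closing | suc k' = ∈-unmatchedClosing⇒closing σ k' w a∈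
  ∈-unmatchedClosing⇒closing σ k (b ∷ w) a∈ | opening | k'     = ∈-unmatchedClosing⇒closing σ (suc k') w a∈
  ∈-unmatchedClosing⇒closing σ k (b ∷ w) a∈ | neutral | k'     = ∈-unmatchedClosing⇒closing σ k' w a∈

  depth-antitone : ∀ {β β' k k'} → β ≼ β' → k' ≤ k → depth β' k' ≤ depth β k
  depth-antitone {opening} ≼-refl k'≤k = s≤s k'≤k
  depth-antitone {neutral} ≼-refl k'≤k = k'≤k
  depth-antitone {closing} ≼-refl k'≤k = pred-mono-≤ k'≤k
  depth-antitone opening≼neutral  k'≤k = m≤n⇒m≤1+n k'≤k
  depth-antitone opening≼closing  k'≤k = m≤n⇒m≤1+n (≤-trans pred[n]≤n k'≤k)
  depth-antitone neutral≼closing  k'≤k = ≤-trans pred[n]≤n k'≤k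

  ∈-emit⁺ : ∀ β k {a b : A} {w} → a ∈ w → a ∈ emit β k b w
  ∈-emit⁺ closing zero    a∈w = there a∈w
  ∈-emit⁺ closing (suc k) a∈w = a∈w
  ∈-emit⁺ opening k       a∈w = a∈w
  ∈-emit⁺ neutral k       a∈w = a∈w

  ∈-emit-mono : ∀ {β β' k k'} {a b : A} {w w'} → β ≼ β' → k' ≤ k →
    (a ∈ w → a ∈ w') → a ∈ emit β k b w → a ∈ emit β' k' b w'
  ∈-emit-mono {closing} {k = zero} ≼-refl z≤n w⊆w' (here a≡b)  = here a≡b
  ∈-emit-mono {closing} {k = zero} ≼-refl z≤n w⊆w' (there a∈w) = there (w⊆w' a∈w)
  ∈-emit-mono {closing} {β'} {suc k} {k'} _ _ w⊆w' a∈w = ∈-emit⁺ β' k' (w⊆w' a∈w)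
  ∈-emit-mono {opening} {β'} {k' = k'}    _ _ w⊆w' a∈w = ∈-emit⁺ β' k' (w⊆w' a∈w)
  ∈-emit-mono {neutral} {β'} {k' = k'}    _ _ w⊆w' a∈w = ∈-emit⁺ β' k' (w⊆w' a∈w)

  unmatchedClosing-mono : ∀ {σ σ' : A → Bracket} → (∀ a → σ a ≼ σ' a) →
    ∀ w {k k'} → k' ≤ k → ∀ {a} → a ∈ unmatchedClosing σ k w → a ∈ unmatchedClosing σ' k' w
  unmatchedClosing-mono σ≼σ' (b ∷ w) k'≤k =
    ∈-emit-mono (σ≼σ' b) k'≤k (unmatchedClosing-mono σ≼σ' w (depth-antitone (σ≼σ' b) k'≤k))

∈-last : ∀ {A : Set} (l : List A) {a} → last l ≡ just a → a ∈ l
∈-last (b ∷ [])    refl = here refl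
∈-last (b ∷ c ∷ l) e    = there (∈-last (c ∷ l) e)

≡ᵇ-refl : ∀ m → (m ≡ᵇ m) ≡ true
≡ᵇ-refl zero    = refl
≡ᵇ-refl (suc m) = ≡ᵇ-refl m

m≡ᵇ1+m : ∀ m → (m ≡ᵇ suc m) ≡ false
m≡ᵇ1+m zero    = refl
m≡ᵇ1+m (suc m) = m≡ᵇ1+m m

1+m≡ᵇm : ∀ m → (suc m ≡ᵇ m) ≡ false
1+m≡ᵇm zero    = refl
1+m≡ᵇm (suc m) = 1+m≡ᵇm m

T-∧-≡ᵇ : ∀ p {m n} → T (p ∧ (m ≡ᵇ n)) ⇔ (T p × m ≡ n)
T-∧-≡ᵇ false = mk⇔ (λ ()) (λ ())
T-∧-≡ᵇ true  = mk⇔ (λ t → _ , ≡ᵇ⇒≡ _ _ t) (λ (_ , e) → ≡⇒≡ᵇ _ _ e)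

≡ˢ⇒≡ : ∀ s s' → T (s ≡ˢ s') → s ≡ s'
≡ˢ⇒≡ TS TS _ = refl
≡ˢ⇒≡ US US _ = refl

≡ᶜ⇒≡ : ∀ a a' → T (a ≡ᶜ a') → a ≡ a'
≡ᶜ⇒≡ (s , r , c) (s' , r' , c') t
  with ts , trc ← to (T-∧ {s ≡ˢ s'}) t
  with tr , tc ← to (T-∧ {r ≡ᵇ r'}) trc
  = cong₂ _,_ (≡ˢ⇒≡ s s' ts) (cong₂ _,_ (≡ᵇ⇒≡ r r' tr) (≡ᵇ⇒≡ c c' tc))

valueBracket : ℕ → ℕ → Bracket
valueBracket i v = if v ≡ᵇ suc i then opening else (if v ≡ᵇ i then closing else neutral)

valueBracket-closing : ∀ i → valueBracket i i ≡ closing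
valueBracket-closing zero    = refl
valueBracket-closing (suc i) = valueBracket-closing i

valueBracket-opening : ∀ i → valueBracket i (suc i) ≡ opening
valueBracket-opening zero    = refl
valueBracket-opening (suc i) = valueBracket-opening i

valueBracket-closing⁻ : ∀ i v → valueBracket i v ≡ closing → v ≡ i
valueBracket-closing⁻ zero    zero          _ = refl
valueBracket-closing⁻ (suc i) (suc v)       e = cong suc (valueBracket-closing⁻ i v e)
valueBracket-closing⁻ zero    (suc zero)    ()
valueBracket-closing⁻ zero    (suc (suc v)) ()
valueBracket-closing⁻ (suc i) zero          ()

valueBracket-opening⁻ : ∀ i v → valueBracket i v ≡ opening → v ≡ suc i
valueBracket-opening⁻ zero    (suc zero)    _ = refl
valueBracket-opening⁻ (suc i) (suc v)       e = cong suc (valueBracket-opening⁻ i v e)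
valueBracket-opening⁻ zero    zero          ()
valueBracket-opening⁻ zero    (suc (suc v)) ()
valueBracket-opening⁻ (suc i) zero          ()

-- x ↦ y only moves the letters of the i-bracket word upwards in the order ( < neutral < ).
record MoreClosing (i : ℕ) (x y : Filling) : Set where
  field
    keeps-i          : ∀ {a} → x a ≡ i → y a ≡ i
    creates-no-suc-i : ∀ {a} → y a ≡ suc i → x a ≡ suc i

module ShuffleBrackets (n : ℕ) (lam mu nu rho : ℕ → ℕ) where
  open Shape n lam mu nu rho

  PairedBelow : ℕ → Filling → Cell → Set
  PairedBelow i x (s , r , c) = T (inShape? (s , suc r , c)) × x (s , suc r , c) ≡ suc i

  PairedAbove : ℕ → Filling → Cell → Set
  PairedAbove i x (s , zero , c)  = ⊥
  PairedAbove i x (s , suc r , c) = T (inShape? (s , r , c)) × x (s , r , c) ≡ i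

  colPaired-at-i : ∀ {i x s r c} → x (s , r , c) ≡ i →
    T (colPaired i x (s , r , c)) ⇔ PairedBelow i x (s , r , c)
  colPaired-at-i {i} {x} {s} {zero} {c} xa
    rewrite xa | ≡ᵇ-refl i | ∨-identityʳ (inShape? (s , 1 , c) ∧ (x (s , 1 , c) ≡ᵇ suc i))
    = T-∧-≡ᵇ _
  colPaired-at-i {i} {x} {s} {suc r} {c} xa
    rewrite xa | ≡ᵇ-refl i | m≡ᵇ1+m i
          | ∨-identityʳ (inShape? (s , suc (suc r) , c) ∧ (x (s , suc (suc r) , c) ≡ᵇ suc i))
    = T-∧-≡ᵇ _

  colPaired-at-suc-i : ∀ {i x s r c} → x (s , r , c) ≡ suc i →
    T (colPaired i x (s , r , c)) ⇔ PairedAbove i x (s , r , c)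
  colPaired-at-suc-i {i} {r = zero}  xa rewrite xa | 1+m≡ᵇm i = mk⇔ (λ ()) (λ ())
  colPaired-at-suc-i {i} {r = suc r} xa rewrite xa | 1+m≡ᵇm i | ≡ᵇ-refl i = T-∧-≡ᵇ _

  PairedAbove-map : ∀ {i x y} → (∀ {a} → x a ≡ i → y a ≡ i) → ∀ a → PairedAbove i x a → PairedAbove i y a
  PairedAbove-map keep (s , suc r , c) = map₂ keep

  -- Column-paired cells are read as neutral letters, which is the same as deleting them.
  bracketOf : ℕ → Filling → Cell → Bracket
  bracketOf i x a = if not (colPaired i x a) then valueBracket i (x a) else neutral

  unpaired≡unmatchedClosing : ∀ i x → unpaired i x ≡ unmatchedClosing (bracketOf i x) 0 readingWord
  unpaired≡unmatchedClosing i x =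
    trans (unmatched≡ 0 (filterᵇ (λ a → not (colPaired i x a)) readingWord)) (unmatchedClosing-filterᵇ (valueBracket i ∘ x) _ 0 readingWord)
    where
    unmatched≡ : ∀ k w → unmatched i x k w ≡ unmatchedClosing (valueBracket i ∘ x) k w
    unmatched≡ k [] = refl
    unmatched≡ k (a ∷ w) with x a ≡ᵇ suc i
    ... | true = unmatched≡ (suc k) w
    ... | false with x a ≡ᵇ i
    ...   | false = unmatched≡ k w
    ...   | true with k
    ...     | zero   = cong (a ∷_) (unmatched≡ zero w)
    ...     | suc k' = unmatched≡ k' w

  bracketOf-closing : ∀ i x a → bracketOf i x a ≡ closing ⇔ (¬ T (colPaired i x a) × x a ≡ i)
  bracketOf-closing i x a with colPaired i x a
  ... | true  = mk⇔ (λ ()) (λ (unpaired , _) → ⊥-elim (unpaired _))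
  ... | false = mk⇔ (λ e → (λ ()) , valueBracket-closing⁻ i (x a) e)
                    (λ (_ , xa) → subst (λ v → valueBracket i v ≡ closing) (sym xa) (valueBracket-closing i))

  bracketOf-opening : ∀ i x a → bracketOf i x a ≡ opening ⇔ (¬ T (colPaired i x a) × x a ≡ suc i)
  bracketOf-opening i x a with colPaired i x a
  ... | true  = mk⇔ (λ ()) (λ (unpaired , _) → ⊥-elim (unpaired _))
  ... | false = mk⇔ (λ e → (λ ()) , valueBracket-opening⁻ i (x a) e)
                    (λ (_ , xa) → subst (λ v → valueBracket i v ≡ opening) (sym xa) (valueBracket-opening i))

  ∈-unpaired⇒≡ : ∀ i x {a} → a ∈ unpaired i x → x a ≡ i
  ∈-unpaired⇒≡ i x {a} a∈ =
    proj₂ (to (bracketOf-closing i x a)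
      (∈-unmatchedClosing⇒closing (bracketOf i x) 0 readingWord (subst (a ∈_) (unpaired≡unmatchedClosing i x) a∈)))

  module _ {i x y} (more : MoreClosing i x y) where
    open MoreClosing more

    closing-preserved : ∀ a → bracketOf i x a ≡ closing → bracketOf i y a ≡ closing
    closing-preserved a@(s , r , c) bx with unpairedˣ , xa ← to (bracketOf-closing i x a) bx =
      from (bracketOf-closing i y a) (unpairedʸ , ya)
      where
      ya : y a ≡ i
      ya = keeps-i xa
      unpairedʸ : ¬ T (colPaired i y a)
      unpairedʸ t = unpairedˣ (from (colPaired-at-i {x = x} xa) (map₂ creates-no-suc-i (to (colPaired-at-i {x = y} ya) t)))

    opening-reflected : ∀ a → bracketOf i y a ≡ opening → bracketOf i x a ≡ opening
    opening-reflected a@(s , r , c) by with unpairedʸ , ya ← to (bracketOf-opening i y a) by =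
      from (bracketOf-opening i x a) (unpairedˣ , xa)
      where
      xa : x a ≡ suc i
      xa = creates-no-suc-i ya
      unpairedˣ : ¬ T (colPaired i x a)
      unpairedˣ t =
        unpairedʸ (from (colPaired-at-suc-i {x = y} ya) (PairedAbove-map keeps-i a (to (colPaired-at-suc-i {x = x} xa) t)))

    unpaired-mono : ∀ {a} → a ∈ unpaired i x → a ∈ unpaired i y
    unpaired-mono {a} a∈ =
      subst (a ∈_) (sym (unpaired≡unmatchedClosing i y))
        (unmatchedClosing-mono bracket≼ readingWord z≤n (subst (a ∈_) (unpaired≡unmatchedClosing i x) a∈))
      where
      bracket≼ : ∀ a → bracketOf i x a ≼ bracketOf i y a
      bracket≼ a = ≼-intro _ _ (closing-preserved a) (opening-reflected a)

  f-raises-one-j : ∀ {j x y} → f j x ≡ just y → ∀ a → y a ≡ x a ⊎ (x a ≡ j × y a ≡ suc j)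
  f-raises-one-j {j} {x} fx≡y a with last (unpaired j x) in last≡
  ... | nothing with () ← fx≡y
  ... | just a₀ with refl ← fx≡y with a ≡ᶜ a₀ in a≡ᶜa₀
  ...   | false = inj₁ refl
  ...   | true with refl ← ≡ᶜ⇒≡ a a₀ (from T-≡ a≡ᶜa₀) = inj₂ (∈-unpaired⇒≡ j x (∈-last (unpaired j x) last≡) , refl)

  f-moreClosing : ∀ {i j x y} → f j x ≡ just y → i ≢ j → MoreClosing i x y
  f-moreClosing {i} {j} {x} {y} fx≡y i≢j = record { keeps-i = keeps ; creates-no-suc-i = creates-none }
    where
    keeps : ∀ {a} → x a ≡ i → y a ≡ i
    keeps {a} xa with f-raises-one-j fx≡y a
    ... | inj₁ ya        = trans ya xa
    ... | inj₂ (xa' , _) = ⊥-elim (i≢j (trans (sym xa) xa'))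
    creates-none : ∀ {a} → y a ≡ suc i → x a ≡ suc i
    creates-none {a} ya with f-raises-one-j fx≡y a
    ... | inj₁ ya'       = trans (sym ya') ya
    ... | inj₂ (_ , ya') = ⊥-elim (i≢j (suc-injective (trans (sym ya) ya')))

lemma2p15 : (n N : ℕ) (lam mu nu rho : ℕ → ℕ) (b : ℕ → ℕ) →
    IsPartition n lam → IsPartition n mu → IsPartition n nu → IsPartition n rho →
    Contained n mu lam → Contained n rho nu →
    (∀ l l' → 1 ≤ l → l ≤ l' → l' ≤ 2 * n → b l ≤ b l') →
    (x : Filling) → Shape.ShuffleTableau n lam mu nu rho N b x →
    (j : ℕ) → 1 ≤ j → j < N →
    (y : Filling) → Shape.f n lam mu nu rho j x ≡ just y →
    (i : ℕ) → 1 ≤ i → i < N → i ≢ j →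
    (a : Cell) → a ∈ Shape.unpaired n lam mu nu rho i x →
    a ∈ Shape.unpaired n lam mu nu rho i y
lemma2p15 n N lam mu nu rho b _ _ _ _ _ _ _ x _ j _ _ y fx≡y i _ _ i≢j a =
  unpaired-mono (f-moreClosing fx≡y i≢j)
  where open ShuffleBrackets n lam mu nu rho
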